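{- Let $F$ be a 4-regular graph, and let $C$ and $C'$ be Euler systems of $F$. Then the matrices $M(C)$ and $M(C')$ represent the same binary matroid on $\mathfrak{T}(F)$.
   Context: Graphs may have loops and multiple edges; each edge consists of two half-edges, each incident on one vertex; a 4-regular graph has four half-edges at each vertex. A transition at a vertex $v$ is a partition of the four half-edges at $v$ into two pairs; $\mathfrak{T}(F)$ is the set of all transitions of $F$. An Euler system $C$ of $F$ is a set containing, for each connected component, one closed walk (circuit, up to cyclic permutation and reversal) using every half-edge of that component exactly once. Vertices $v\neq w$ are interlaced with respect to $C$ if they appear in the order $v\dots w\dots v\dots w$ on a circuit of $C$; the interlacement graph $\mathcal{I}(C)$ is the simple graph on $V(F)$ whose edges are the interlaced pairs, and $\mathcal{A}(\mathcal{I}(C))$ is its adjacency matrix over $GF(2)$. For each vertex $v$, $\phi_C(v)$ is the transition used by the circuit of $C$ through $v$; orienting this circuit, $\chi_C(v)$ is the other transition in which each pair consists of a half-edge where the circuit enters $v$ and one where it leaves; $\psi_C(v)$ is the remaining transition. $M(C)=(I\mid\mathcal{A}(\mathcal{I}(C))\mid I+\mathcal{A}(\mathcal{I}(C)))$ over $GF(2)$, rows indexed by $V(F)$, where the column of $I$ corresponding to $v$ is indexed by $\phi_C(v)$, the column of $\mathcal{A}(\mathcal{I}(C))$ corresponding to $v$ by $\chi_C(v)$, and the column of $I+\mathcal{A}(\mathcal{I}(C))$ corresponding to $v$ by $\psi_C(v)$. A matrix with columns indexed by a set $S$ represents the binary matroid on $S$ in which the rank of $A\subseteq S$ is the $GF(2)$-rank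 of the columns indexed by $A$. -}

module Defs where

open import Data.Nat using (ℕ; zero; suc; _≤_; _+_)
open import Data.Fin using (Fin; zero; suc)
open import Data.Fin.Properties using () renaming (_≟_ to _≟ᶠ_)
open import Data.Bool using (Bool; true; false; _∧_; _∨_; _xor_; not; if_then_else_)
open import Data.Product using (Σ; ∃; _×_; _,_; proj₁; proj₂)
open import Data.Product.Properties using (≡-dec)
open import Data.List using (List; []; _∷_; _++_; [_]; map; concat; concatMap; filter; foldr; tabulate)
open import Data.List.Membership.Propositional using (_∈_)
open import Data.List.Relation.Unary.Unique.Propositional using (Unique)
open import Data.Unit using (⊤)
open import Data.Empty using (⊥)
open import Relation.Nullary using (¬_)
open import Relation.Nullary.Decidable using (⌊_⌋; _⊎-dec_)
open import Relation.Binary.PropositionalEquality using (_≡_; _≢_)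
open import Relation.Binary.Construct.Closure.ReflexiveTransitive using (Star)

-- 4-regular graphs (loops and multiple edges allowed)
--
-- Vertices are Fin n; the four half-edges at vertex v are (v , i), i : Fin 4.
-- Edges are given by a fixed-point-free involution σ on half-edges:
-- the two half-edges of an edge are h and σ h.  (A loop at v is an edge
-- whose two half-edges are both at v.)

HalfEdge : ℕ → Set
HalfEdge n = Fin n × Fin 4

record FourRegular (n : ℕ) : Set where
  field
    σ       : HalfEdge n → HalfEdge n
    σ-invol : ∀ h → σ (σ h) ≡ h
    σ-nofix : ∀ h → σ h ≢ h

open FourRegular public

Adj : ∀ {n} → FourRegular n → Fin n → Fin n → Set
Adj F v w = Σ (Fin 4) λ i → Σ (Fin 4) λ j → σ F (v , i) ≡ (w , j)

Connected : ∀ {n} → FourRegular n → Fin n → Fin n → Set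
Connected F = Star (Adj F)

-- A transition at v is a partition of {0,1,2,3} (the half-edges at v)
-- into two pairs; it is determined by the partner of half-edge 0.
-- We encode it by t : Fin 3, where the partner of 0 is t+1:
--   0 ↦ {0,1}{2,3},  1 ↦ {0,2}{1,3},  2 ↦ {0,3}{1,2}.

Transition : Set
Transition = Fin 3

Tr : ℕ → Set
Tr n = Fin n × Transition

-- the transition containing the pair {x , y} (x ≠ y); junk value if x = y
pairT : Fin 4 → Fin 4 → Transition
pairT zero (suc zero)                     = zero
pairT zero (suc (suc zero))               = suc zero
pairT zero (suc (suc (suc zero)))         = suc (suc zero)
pairT (suc zero) zero                     = zero
pairT (suc (suc zero)) zero               = suc zero
pairT (suc (suc (suc zero))) zero         = suc (suc zero)
pairT (suc (suc zero)) (suc (suc (suc zero))) = zero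
pairT (suc (suc (suc zero))) (suc (suc zero)) = zero
pairT (suc zero) (suc (suc (suc zero)))   = suc zero
pairT (suc (suc (suc zero))) (suc zero)   = suc zero
pairT (suc zero) (suc (suc zero))         = suc (suc zero)
pairT (suc (suc zero)) (suc zero)         = suc (suc zero)
pairT _ _                                 = zero

-- A closed walk is recorded as the cyclic list of its passages through
-- vertices, in the direction of travel.  A passage (v , a , b) means: the
-- walk enters v through half-edge (v , a) and leaves through (v , b).

Passage : ℕ → Set
Passage n = Fin n × Fin 4 × Fin 4

pv : ∀ {n} → Passage n → Fin n
pv (v , _ , _) = v

halves : ∀ {n} → Passage n → List (HalfEdge n)
halves (v , a , b) = (v , a) ∷ (v , b) ∷ []

Link : ∀ {n} → FourRegular n → Passage n → Passage n → Set
Link F (v , a , b) (w , c , d) = σ F (v , b) ≡ (w , c)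

Chain : ∀ {n} → FourRegular n → List (Passage n) → Set
Chain F []            = ⊤
Chain F (p ∷ [])      = ⊤
Chain F (p ∷ q ∷ ps)  = Link F p q × Chain F (q ∷ ps)

ClosedWalk : ∀ {n} → FourRegular n → List (Passage n) → Set
ClosedWalk F []       = ⊥
ClosedWalk F (p ∷ ps) = Chain F (p ∷ ps ++ [ p ])

-- A candidate Euler system: k circuits (representatives up to cyclic
-- permutation and reversal).
record EulerSystem (n : ℕ) : Set where
  field
    k    : ℕ
    circ : Fin k → List (Passage n)

open EulerSystem public

allPassages : ∀ {n} → EulerSystem n → List (Passage n)
allPassages C = concat (tabulate (circ C))

usedHalves : ∀ {n} → EulerSystem n → List (HalfEdge n)
usedHalves C = concatMap halves (allPassages C)

OnCircuit : ∀ {n} (C : EulerSystem n) → Fin (k C) → Fin n → Set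
OnCircuit C i v = v ∈ map pv (circ C i)

-- C is an Euler system of F: every circuit is a closed walk of F, every
-- half-edge is used exactly once, and there is exactly one circuit per
-- connected component (two circuits meeting connected vertices coincide;
-- every component has a circuit since all half-edges are used).
record IsEulerSystem {n : ℕ} (F : FourRegular n) (C : EulerSystem n) : Set where
  field
    closed   : ∀ i → ClosedWalk F (circ C i)
    unique   : Unique (usedHalves C)
    covering : ∀ h → h ∈ usedHalves C
    oneEach  : ∀ i j v w → OnCircuit C i v → OnCircuit C j w →
               Connected F v w → i ≡ j

-- With respect to an Euler system each vertex v is passed exactly twice,
-- say (v , a , b) and (v , c , d) in this order along its (oriented) circuit.
-- φ_C(v) = {a,b}{c,d}, χ_C(v) = {a,d}{c,b} (in/out pairs other than φ),
-- ψ_C(v) = {a,c}{b,d}.  (Junk value if v is not passed exactly twice.)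

passagesAt : ∀ {n} → EulerSystem n → Fin n → List (Passage n)
passagesAt C v = filter (λ p → pv p ≟ᶠ v) (allPassages C)

φ : ∀ {n} → EulerSystem n → Fin n → Transition
φ C v with passagesAt C v
... | (_ , a , b) ∷ (_ , c , d) ∷ [] = pairT a b
... | _ = zero

χ : ∀ {n} → EulerSystem n → Fin n → Transition
χ C v with passagesAt C v
... | (_ , a , b) ∷ (_ , c , d) ∷ [] = pairT a d
... | _ = zero

ψ : ∀ {n} → EulerSystem n → Fin n → Transition
ψ C v with passagesAt C v
... | (_ , a , b) ∷ (_ , c , d) ∷ [] = pairT a c
... | _ = zero

-- v ≠ w are interlaced iff on some circuit they appear in the (cyclic)
-- order v … w … v … w, i.e. the subsequence of the circuit's vertex
-- sequence consisting of the occurrences of v and w is v w v w or w v w v.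

_==_ : ∀ {n} → Fin n → Fin n → Bool
x == y = ⌊ x ≟ᶠ y ⌋

alternates : ∀ {n} → Fin n → Fin n → List (Fin n) → Bool
alternates v w (a ∷ b ∷ c ∷ d ∷ []) = (a == v) ∧ (b == w) ∧ (c == v) ∧ (d == w)
alternates v w _ = false

interlacedOn : ∀ {n} → Fin n → Fin n → List (Fin n) → Bool
interlacedOn v w l = alternates v w l' ∨ alternates w v l'
  where l' = filter (λ x → (x ≟ᶠ v) ⊎-dec (x ≟ᶠ w)) l

anyFin : ∀ {m} → (Fin m → Bool) → Bool
anyFin f = foldr _∨_ false (tabulate f)

-- adjacency matrix 𝒜(ℐ(C)) over GF(2) = Bool (xor, ∧)
interlaced : ∀ {n} → EulerSystem n → Fin n → Fin n → Bool
interlaced C v w =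
  not (v == w) ∧ anyFin (λ i → interlacedOn v w (map pv (circ C i)))

-- M(C) = (I | 𝒜 | I + 𝒜), columns indexed by 𝔗(F) = Fin n × Fin 3:
-- the column (v , t) is the v-th column of I if t = φ_C(v), of 𝒜 if
-- t = χ_C(v), of I + 𝒜 if t = ψ_C(v).

δ : ∀ {n} → Fin n → Fin n → Bool
δ u v = u == v

M : ∀ {n} → EulerSystem n → Fin n → Tr n → Bool
M C u (v , t) =
  if t == φ C v then δ u v
  else if t == χ C v then interlaced C u v
  else if t == ψ C v then (δ u v xor interlaced C u v)
  else false

TrSet : ℕ → Set
TrSet n = Tr n → Bool

_⊆_ : ∀ {n} → TrSet n → TrSet n → Set
B ⊆ A = ∀ x → B x ≡ true → A x ≡ true

xorFin : ∀ {m} → (Fin m → Bool) → Bool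
xorFin f = foldr _xor_ false (tabulate f)

countFin : ∀ {m} → (Fin m → Bool) → ℕ
countFin f = foldr (λ b r → if b then suc r else r) zero (tabulate f)

card : ∀ {n} → TrSet n → ℕ
card {n} S = foldr _+_ zero (tabulate {n = n} (λ v → countFin (λ t → S (v , t))))

colSum : ∀ {n} → (Fin n → Tr n → Bool) → TrSet n → Fin n → Bool
colSum {n} N S u = xorFin (λ v → xorFin (λ t → S (v , t) ∧ N u (v , t)))

Nonempty : ∀ {n} → TrSet n → Set
Nonempty S = ∃ λ x → S x ≡ true

Independent : ∀ {n} → (Fin n → Tr n → Bool) → TrSet n → Set
Independent N B = ∀ S → S ⊆ B → Nonempty S → ¬ (∀ u → colSum N S u ≡ false)

HasRank : ∀ {n} → (Fin n → Tr n → Bool) → TrSet n → ℕ → Set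
HasRank N A r =
  (∃ λ B → B ⊆ A × Independent N B × card B ≡ r) ×
  (∀ B → B ⊆ A → Independent N B → card B ≤ r)

SameMatroid : ∀ {n} → (Fin n → Tr n → Bool) → (Fin n → Tr n → Bool) → Set
SameMatroid N N' = ∀ A r → (HasRank N A r → HasRank N' A r) × (HasRank N' A r → HasRank N A r)

-- Write across z for the function (v , t) ↦ z (v , 0) + z (v , suc t) on transitions, z being
-- a GF(2)-valued function on half-edges. For a vertex u let loop u be the indicator of the
-- half-edges traversed by the closed walk that follows the circuit of C from its first
-- departure from u to its next return to u; it lies in the cycle space of F. At a vertex v
-- passed as (a , b) and then as (c , d), loop u differs on a and b exactly when v = u, and
-- differs on a and d exactly when the walk visits v once, i.e. when u and v are interlaced;
-- so across (loop u) is row u of M(C). Conversely, for a cycle z, subtracting from z the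
-- combination of the loops with coefficient z (u , a) + z (u , b) at u leaves a function that
-- is constant at every vertex, which across annihilates; so across z is the same combination
-- of rows of M(C). Thus the row space of M(C) is the image of the cycle space of F under
-- across, which does not depend on C, and matrices with equal row spaces have the same
-- dependent sets of columns.

module Submission where

open import Defs
open import Algebra.Bundles using (CommutativeRing; CommutativeMonoid)
open import Data.Bool using (Bool; true; false; _∧_; _∨_; _xor_; if_then_else_)
open import Data.Bool.Properties
  using (xor-assoc; xor-comm; xor-same; xor-identityʳ; ∧-distribˡ-xor; ∧-zeroʳ; ∧-identityʳ; ∨-identityʳ;
         xor-∧-commutativeRing)
open import Data.Fin using (Fin; zero; suc)
open import Data.Fin.Properties using (all?; suc-injective) renaming (_≟_ to _≟ᶠ_)
open import Data.List using (List; []; _∷_; _++_; concatMap; concat; tabulate; filter; map)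
open import Data.List.Properties
  using (filter-++; filter-accept; filter-reject; filter-none; ∷-injectiveˡ; ∷-injectiveʳ; ++-assoc;
         ++-conicalˡ; ++-conicalʳ; map-++; concatMap-++)
open import Data.Nat using (ℕ; zero; suc)
open import Data.Product using (Σ; ∃; _×_; _,_; proj₁; proj₂)
open import Data.Product.Properties using (≡-dec)
open import Data.Sum using (_⊎_; inj₁; inj₂; [_,_]′)
import Data.Sum as Sum
open import Function using (_∘_)
open import Data.List.Membership.Propositional using (_∈_; _∉_)
open import Data.List.Membership.Propositional.Properties
  using (∈-++⁺ˡ; ∈-++⁺ʳ; ∈-filter⁺; ∈-filter⁻; ∈-map⁺; ∈-concat⁺′; ∈-concat⁻′; ∈-tabulate⁺; ∈-tabulate⁻)
open import Data.List.Relation.Unary.All using (All; []; _∷_)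
open import Data.List.Relation.Unary.AllPairs using ([]; _∷_)
import Data.List.Relation.Unary.AllPairs as AllPairs
open import Data.List.Relation.Unary.Any using (here; there)
open import Data.List.Relation.Unary.Unique.Propositional using (Unique)
import Data.List.Relation.Unary.All as All
import Data.List.Relation.Unary.All.Properties as All
open import Relation.Nullary using (¬_; Dec; yes; no; contradiction)
open import Relation.Unary using (Decidable; ∁)
open import Relation.Nullary.Decidable using (⌊⌋-map′; from-yes; ¬?; _×-dec_; _⊎-dec_; _→-dec_)
open import Relation.Binary.Construct.Closure.ReflexiveTransitive using (ε)
open import Relation.Binary.PropositionalEquality

open import Algebra.Properties.CommutativeSemigroup
  (CommutativeMonoid.commutativeSemigroup (CommutativeRing.+-commutativeMonoid xor-∧-commutativeRing))
  using () renaming (interchange to xor-interchange; x∙yz≈y∙xz to xor-exchange)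
open import Algebra.Properties.CommutativeSemigroup
  (CommutativeMonoid.commutativeSemigroup (CommutativeRing.*-commutativeMonoid xor-∧-commutativeRing))
  using () renaming (x∙yz≈y∙xz to ∧-exchange)

xor-cancelʳ : ∀ x y → (x xor y) xor y ≡ x
xor-cancelʳ x y = begin
  (x xor y) xor y  ≡⟨ xor-assoc x y y ⟩
  x xor (y xor y)  ≡⟨ cong (x xor_) (xor-same y) ⟩
  x xor false      ≡⟨ xor-identityʳ x ⟩
  x                ∎
  where open ≡-Reasoning

xor≡false⇒≡ : ∀ {x y} → x xor y ≡ false → x ≡ y
xor≡false⇒≡ {x} {y} x⊕y≡0 = trans (sym (xor-cancelʳ x y)) (cong (_xor y) x⊕y≡0)

==-refl : ∀ {m} (x : Fin m) → (x == x) ≡ true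
==-refl x with x ≟ᶠ x
... | yes _   = refl
... | no x≢x = contradiction refl x≢x

==-≢ : ∀ {m} {x y : Fin m} → x ≢ y → (x == y) ≡ false
==-≢ {x = x} {y} x≢y with x ≟ᶠ y
... | yes x≡y = contradiction x≡y x≢y
... | no _    = refl

==-sym : ∀ {m} (x y : Fin m) → (x == y) ≡ (y == x)
==-sym x y with x ≟ᶠ y
... | yes refl = sym (==-refl x)
... | no x≢y  = sym (==-≢ (x≢y ∘ sym))

xor-through : ∀ x y z → x xor z ≡ (x xor y) xor (y xor z)
xor-through x y z = sym (begin
  (x xor y) xor (y xor z)  ≡⟨ xor-assoc x y (y xor z) ⟩
  x xor (y xor (y xor z))  ≡⟨ cong (x xor_) (sym (xor-assoc y y z)) ⟩
  x xor ((y xor y) xor z)  ≡⟨ cong (λ w → x xor (w xor z)) (xor-same y) ⟩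
  x xor z                  ∎)
  where open ≡-Reasoning

xor-cancelˡ-common : ∀ x y w → (x xor y) xor (x xor w) ≡ y xor w
xor-cancelˡ-common x y w = trans (xor-interchange x y x w) (cong (_xor (y xor w)) (xor-same x))

-- Sums over GF(2)

xorFin-cong : ∀ {m} {f g : Fin m → Bool} → (∀ i → f i ≡ g i) → xorFin f ≡ xorFin g
xorFin-cong {zero}  f≗g = refl
xorFin-cong {suc m} f≗g = cong₂ _xor_ (f≗g zero) (xorFin-cong (f≗g ∘ suc))

xorFin-false : ∀ m → xorFin {m} (λ _ → false) ≡ false
xorFin-false zero    = refl
xorFin-false (suc m) = xorFin-false m

xorFin-xor : ∀ {m} (f g : Fin m → Bool) → xorFin (λ i → f i xor g i) ≡ xorFin f xor xorFin g
xorFin-xor {zero}  f g = refl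
xorFin-xor {suc m} f g =
  trans (cong ((f zero xor g zero) xor_) (xorFin-xor (f ∘ suc) (g ∘ suc)))
        (xor-interchange (f zero) (g zero) _ _)

xorFin-∧ : ∀ {m} (b : Bool) (f : Fin m → Bool) → xorFin (λ i → b ∧ f i) ≡ b ∧ xorFin f
xorFin-∧ {zero}  b f = sym (∧-zeroʳ b)
xorFin-∧ {suc m} b f =
  trans (cong ((b ∧ f zero) xor_) (xorFin-∧ b (f ∘ suc))) (sym (∧-distribˡ-xor b (f zero) _))

xorFin-swap : ∀ {m l} (f : Fin m → Fin l → Bool) →
              xorFin (λ i → xorFin (f i)) ≡ xorFin (λ j → xorFin (λ i → f i j))
xorFin-swap {zero}  {l} f = sym (xorFin-false l)
xorFin-swap {suc m}     f =
  trans (cong (xorFin (f zero) xor_) (xorFin-swap (f ∘ suc)))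
        (sym (xorFin-xor (f zero) (λ j → xorFin (λ i → f (suc i) j))))

xorFin-select : ∀ {m} (X : Fin m → Bool) (w : Fin m) → xorFin (λ u → X u ∧ (w == u)) ≡ X w
xorFin-select {suc m} X zero = begin
  (X zero ∧ true) xor xorFin (λ u → X (suc u) ∧ false)  ≡⟨ cong₂ _xor_ (∧-identityʳ (X zero)) rest≡false ⟩
  X zero xor false                                      ≡⟨ xor-identityʳ (X zero) ⟩
  X zero                                                ∎
  where
  open ≡-Reasoning
  rest≡false : xorFin (λ u → X (suc u) ∧ false) ≡ false
  rest≡false = trans (xorFin-cong (∧-zeroʳ ∘ X ∘ suc)) (xorFin-false m)
xorFin-select {suc m} X (suc w) =
  trans (cong₂ _xor_ (∧-zeroʳ (X zero)) (xorFin-cong λ u → cong (X (suc u) ∧_) (⌊⌋-map′ _ _ (w ≟ᶠ u))))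
        (xorFin-select (X ∘ suc) w)

parity : ∀ {A : Set} → (A → Bool) → List A → Bool
parity f []       = false
parity f (a ∷ as) = f a xor parity f as

parity-++ : ∀ {A : Set} (f : A → Bool) xs ys → parity f (xs ++ ys) ≡ parity f xs xor parity f ys
parity-++ f []       ys = refl
parity-++ f (x ∷ xs) ys = trans (cong (f x xor_) (parity-++ f xs ys)) (sym (xor-assoc (f x) _ _))

parity-cong : ∀ {A : Set} {f g : A → Bool} {l} → All (λ a → f a ≡ g a) l → parity f l ≡ parity g l
parity-cong []           = refl
parity-cong (fa≡ga ∷ eq) = cong₂ _xor_ fa≡ga (parity-cong eq)

parity-false : ∀ {A : Set} {f : A → Bool} {l} → All (λ a → f a ≡ false) l → parity f l ≡ false
parity-false []            = refl
parity-false (fa≡0 ∷ rest) = cong₂ _xor_ fa≡0 (parity-false rest)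

parity-split : ∀ {A : Set} (f : A → Bool) xs x ys y zs →
  parity f (xs ++ x ∷ ys ++ y ∷ zs) ≡ parity f xs xor (f x xor (parity f ys xor (f y xor parity f zs)))
parity-split f xs x ys y zs =
  trans (parity-++ f xs (x ∷ ys ++ y ∷ zs)) (cong (λ s → parity f xs xor (f x xor s)) (parity-++ f ys (y ∷ zs)))

parity-map : ∀ {A B : Set} (f : B → Bool) (g : A → B) l → parity f (map g l) ≡ parity (f ∘ g) l
parity-map f g []      = refl
parity-map f g (a ∷ l) = cong (f (g a) xor_) (parity-map f g l)

parity-filter : ∀ {A : Set} {P : A → Set} (P? : Decidable P) (f : A → Bool) →
                (∀ a → ¬ P a → f a ≡ false) → ∀ l → parity f (filter P? l) ≡ parity f l
parity-filter P? f vanish []      = refl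
parity-filter P? f vanish (a ∷ l) with P? a
... | yes _  = cong (f a xor_) (parity-filter P? f vanish l)
... | no ¬pa = trans (parity-filter P? f vanish l) (cong (_xor parity f l) (sym (vanish a ¬pa)))

xorFin-parity : ∀ {A : Set} {m} (f : Fin m → A → Bool) l →
                xorFin (λ i → parity (f i) l) ≡ parity (λ a → xorFin (λ i → f i a)) l
xorFin-parity {m = m} f []      = xorFin-false m
xorFin-parity         f (a ∷ l) =
  trans (xorFin-xor (λ i → f i a) (λ i → parity (f i) l)) (cong (xorFin (λ i → f i a) xor_) (xorFin-parity f l))

-- Binary matroids represented by matrices

Kernel : ∀ {n} → (Fin n → Tr n → Bool) → TrSet n → Set
Kernel N S = ∀ u → colSum N S u ≡ false

sameMatroid-if-kernels : ∀ {n} {N N' : Fin n → Tr n → Bool} →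
                         (∀ S → Kernel N S → Kernel N' S) → (∀ S → Kernel N' S → Kernel N S) →
                         SameMatroid N N'
sameMatroid-if-kernels {N = N} {N'} ker⊆ker' ker'⊆ker A r =
  hasRank-transfer {N} {N'} ker'⊆ker ker⊆ker' , hasRank-transfer {N'} {N} ker⊆ker' ker'⊆ker
  where
  independent-transfer : ∀ {M M'} → (∀ S → Kernel M' S → Kernel M S) → ∀ B → Independent M B → Independent M' B
  independent-transfer ker'⊆ B indep S S⊆B S≢∅ S∈ker' = indep S S⊆B S≢∅ (ker'⊆ S S∈ker')

  hasRank-transfer : ∀ {M M'} → (∀ S → Kernel M' S → Kernel M S) → (∀ S → Kernel M S → Kernel M' S) →
                     HasRank M A r → HasRank M' A r
  hasRank-transfer {M} {M'} ker'⊆ ker⊆ ((B , B⊆A , indep , |B|≡r) , maximal) =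
    (B , B⊆A , independent-transfer {M} {M'} ker'⊆ B indep , |B|≡r) ,
    λ B' B'⊆A indep' → maximal B' B'⊆A (independent-transfer {M'} {M} ker⊆ B' indep')

InRowSpace : ∀ {n} → (Fin n → Tr n → Bool) → (Tr n → Bool) → Set
InRowSpace {n} N r = Σ (Fin n → Bool) λ X → ∀ c → r c ≡ xorFin (λ u → X u ∧ N u c)

kernel-antitone : ∀ {n} {N N' : Fin n → Tr n → Bool} → (∀ u' → InRowSpace N (N' u')) →
                  ∀ S → Kernel N S → Kernel N' S
kernel-antitone {n} {N} {N'} rows S S∈ker u' with rows u'
... | X , row≡ = begin
  xorFin (λ v → xorFin (λ t → S (v , t) ∧ N' u' (v , t)))
    ≡⟨ xorFin-cong (λ v → xorFin-cong λ t → cong (S (v , t) ∧_) (row≡ (v , t))) ⟩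
  xorFin (λ v → xorFin (λ t → S (v , t) ∧ xorFin (λ u → X u ∧ N u (v , t))))
    ≡⟨ xorFin-cong (λ v → xorFin-cong λ t → sym (xorFin-∧ (S (v , t)) (λ u → X u ∧ N u (v , t)))) ⟩
  xorFin (λ v → xorFin (λ t → xorFin (λ u → S (v , t) ∧ (X u ∧ N u (v , t)))))
    ≡⟨ xorFin-cong (λ v → xorFin-cong λ t → xorFin-cong λ u → ∧-exchange (S (v , t)) (X u) (N u (v , t))) ⟩
  xorFin (λ v → xorFin (λ t → xorFin (λ u → X u ∧ (S (v , t) ∧ N u (v , t)))))
    ≡⟨ xorFin-cong (λ v → xorFin-swap (λ t u → X u ∧ (S (v , t) ∧ N u (v , t)))) ⟩
  xorFin (λ v → xorFin (λ u → xorFin (λ t → X u ∧ (S (v , t) ∧ N u (v , t)))))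
    ≡⟨ xorFin-swap (λ v u → xorFin (λ t → X u ∧ (S (v , t) ∧ N u (v , t)))) ⟩
  xorFin (λ u → xorFin (λ v → xorFin (λ t → X u ∧ (S (v , t) ∧ N u (v , t)))))
    ≡⟨ xorFin-cong (λ u → trans (xorFin-cong λ v → xorFin-∧ (X u) (λ t → S (v , t) ∧ N u (v , t)))
                                     (xorFin-∧ (X u) (λ v → xorFin (λ t → S (v , t) ∧ N u (v , t))))) ⟩
  xorFin (λ u → X u ∧ colSum N S u)
    ≡⟨ xorFin-cong (λ u → trans (cong (X u ∧_) (S∈ker u)) (∧-zeroʳ (X u))) ⟩
  xorFin {n} (λ _ → false)
    ≡⟨ xorFin-false n ⟩
  false ∎
  where open ≡-Reasoning

++≡pair : ∀ {A : Set} {x y : A} (xs ys : List A) → xs ++ ys ≡ x ∷ y ∷ [] →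
  (xs ≡ [] × ys ≡ x ∷ y ∷ []) ⊎ (xs ≡ x ∷ [] × ys ≡ y ∷ []) ⊎ (xs ≡ x ∷ y ∷ [] × ys ≡ [])
++≡pair []               ys eq = inj₁ (refl , eq)
++≡pair (a ∷ [])         ys eq = inj₂ (inj₁ (cong (_∷ []) (∷-injectiveˡ eq) , ∷-injectiveʳ eq))
++≡pair (a ∷ b ∷ [])     ys eq =
  inj₂ (inj₂ (cong₂ (λ p q → p ∷ q ∷ []) (∷-injectiveˡ eq) (∷-injectiveˡ (∷-injectiveʳ eq)) ,
              ∷-injectiveʳ (∷-injectiveʳ eq)))
++≡pair (a ∷ b ∷ c ∷ xs) ys ()

++≡[_] : ∀ {A : Set} (x : A) xs ys → xs ++ ys ≡ x ∷ [] → (xs ≡ [] × ys ≡ x ∷ []) ⊎ (xs ≡ x ∷ [] × ys ≡ [])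
++≡[ x ] []           ys eq = inj₁ (refl , eq)
++≡[ x ] (a ∷ [])     ys eq = inj₂ (cong (_∷ []) (∷-injectiveˡ eq) , ∷-injectiveʳ eq)
++≡[ x ] (a ∷ b ∷ xs) ys ()

++-regroup : ∀ {A : Set} (pre xs : List A) x ys y zs post →
  pre ++ (xs ++ x ∷ ys ++ y ∷ zs) ++ post ≡ (pre ++ xs) ++ x ∷ ys ++ y ∷ (zs ++ post)
++-regroup []        []       x ys y zs post = cong (x ∷_) (++-assoc ys (y ∷ zs) post)
++-regroup []        (a ∷ xs) x ys y zs post = cong (a ∷_) (++-regroup [] xs x ys y zs post)
++-regroup (a ∷ pre) xs       x ys y zs post = cong (a ∷_) (++-regroup pre xs x ys y zs post)

unique-++⁻ : ∀ {A : Set} (xs : List A) {ys} → Unique (xs ++ ys) →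
             Unique xs × Unique ys × (∀ {a} → a ∈ xs → a ∉ ys)
unique-++⁻ []       unique = [] , unique , λ ()
unique-++⁻ (x ∷ xs) (x∉ ∷ unique) with unique-++⁻ xs unique
... | uxs , uys , disjoint =
  All.tabulate (λ a∈xs x≡a → All.lookup x∉ (∈-++⁺ˡ a∈xs) x≡a) ∷ uxs , uys ,
  λ { (here refl) a∈ys → All.lookup x∉ (∈-++⁺ʳ xs a∈ys) refl ; (there a∈xs) → disjoint a∈xs }

module _ {A : Set} {P : A → Set} (P? : Decidable P) where

  filter≡[]⇒avoids : ∀ {l} → filter P? l ≡ [] → All (∁ P) l
  filter≡[]⇒avoids {[]}    _ = []
  filter≡[]⇒avoids {a ∷ l} eq with P? a
  ... | yes _  = contradiction eq λ ()
  ... | no ¬pa = ¬pa ∷ filter≡[]⇒avoids eq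

  avoids-concat-tabulate : ∀ {K} (cs : Fin K → List A) → All (∁ P) (concat (tabulate cs)) → ∀ j → All (∁ P) (cs j)
  avoids-concat-tabulate cs avoids j = All.tabulate λ a∈csj → All.lookup avoids (∈-concat⁺′ a∈csj (∈-tabulate⁺ j))

  filter≡∷ : ∀ {l x r} → filter P? l ≡ x ∷ r →
             ∃ λ xs → ∃ λ l' → l ≡ xs ++ x ∷ l' × All (∁ P) xs × P x × filter P? l' ≡ r
  filter≡∷ {[]} ()
  filter≡∷ {a ∷ l} eq with P? a
  ... | yes pa = [] , l , cong (_∷ l) a≡x , [] , subst P a≡x pa , ∷-injectiveʳ eq
    where a≡x = ∷-injectiveˡ eq
  ... | no ¬pa with filter≡∷ {l} eq
  ...   | xs , l' , l≡ , avoids , px , rest = a ∷ xs , l' , cong (a ∷_) l≡ , ¬pa ∷ avoids , px , rest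

  record TwoHits (l : List A) (x y : A) : Set where
    field
      before between after : List A
      split          : l ≡ before ++ x ∷ between ++ y ∷ after
      before-avoids  : All (∁ P) before
      between-avoids : All (∁ P) between
      after-avoids   : All (∁ P) after

  filter≡pair : ∀ {l x y} → filter P? l ≡ x ∷ y ∷ [] → TwoHits l x y
  filter≡pair {x = x} eq with filter≡∷ eq
  ... | xs , l' , l≡ , xs-avoids , _ , rest with filter≡∷ rest
  ...   | ys , zs , l'≡ , ys-avoids , _ , rest' = record
    { before = xs ; between = ys ; after = zs
    ; split = trans l≡ (cong (λ t → xs ++ x ∷ t) l'≡)
    ; before-avoids = xs-avoids ; between-avoids = ys-avoids ; after-avoids = filter≡[]⇒avoids rest' }

  filter≡triple : ∀ {l x y w r} → filter P? l ≡ x ∷ y ∷ w ∷ r →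
    ∃ λ xs → ∃ λ ys → ∃ λ zs → ∃ λ ws → l ≡ xs ++ x ∷ ys ++ y ∷ zs ++ w ∷ ws × P x × P y × P w
  filter≡triple {x = x} {y} eq with filter≡∷ eq
  ... | xs , l' , l≡ , _ , px , rest with filter≡∷ rest
  ...   | ys , l'' , l'≡ , _ , py , rest' with filter≡∷ rest'
  ...     | zs , ws , l''≡ , _ , pw , _ =
    xs , ys , zs , ws , trans l≡ (cong (λ t → xs ++ x ∷ t) (trans l'≡ (cong (λ t → ys ++ y ∷ t) l''≡))) , px , py , pw

  record LocalisedHits {K} (cs : Fin K → List A) (x y : A) : Set where
    field
      index       : Fin K
      hits        : TwoHits (cs index) x y
      preceding following : List A
      whole       : concat (tabulate cs) ≡ preceding ++ cs index ++ following
      preceding-avoids : All (∁ P) preceding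
      following-avoids : All (∁ P) following
      others-avoid     : ∀ j → j ≢ index → All (∁ P) (cs j)

  localise : ∀ {K} (cs : Fin K → List A) {x y} →
    (∀ i j {a b} → a ∈ cs i → P a → b ∈ cs j → P b → i ≡ j) →
    filter P? (concat (tabulate cs)) ≡ x ∷ y ∷ [] → LocalisedHits cs x y
  localise {zero}  cs same ()
  localise {suc K} cs {x} {y} same eq
    with ++≡pair (filter P? (cs zero)) (filter P? (concat (tabulate (cs ∘ suc))))
                 (trans (sym (filter-++ P? (cs zero) _)) eq)
  ... | inj₁ (head≡[] , tail≡) = record
    { index = suc L.index ; hits = L.hits
    ; preceding = cs zero ++ L.preceding ; following = L.following
    ; whole = trans (cong (cs zero ++_) L.whole) (sym (++-assoc (cs zero) L.preceding _))
    ; preceding-avoids = All.++⁺ (filter≡[]⇒avoids head≡[]) L.preceding-avoids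
    ; following-avoids = L.following-avoids
    ; others-avoid = others }
    where
    module L = LocalisedHits
      (localise (cs ∘ suc) (λ i j a∈ pa b∈ pb → suc-injective (same (suc i) (suc j) a∈ pa b∈ pb)) tail≡)
    others : ∀ j → j ≢ suc L.index → All (∁ P) (cs j)
    others zero    _      = filter≡[]⇒avoids head≡[]
    others (suc j) j≢     = L.others-avoid j (j≢ ∘ cong suc)
  ... | inj₂ (inj₁ (head≡ , tail≡))
    with ∈-filter⁻ P? {xs = cs zero} (subst (x ∈_) (sym head≡) (here refl))
       | ∈-filter⁻ P? {xs = concat (tabulate (cs ∘ suc))} (subst (y ∈_) (sym tail≡) (here refl))
  ...   | x∈ , px | y∈ , py with ∈-concat⁻′ (tabulate (cs ∘ suc)) y∈
  ...     | ys , y∈ys , ys∈ with ∈-tabulate⁻ ys∈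
  ...       | j , refl = contradiction (same zero (suc j) x∈ px y∈ys py) λ ()
  localise {suc K} cs same eq | inj₂ (inj₂ (head≡ , tail≡[])) = record
    { index = zero ; hits = filter≡pair head≡
    ; preceding = [] ; following = concat (tabulate (cs ∘ suc))
    ; whole = refl ; preceding-avoids = [] ; following-avoids = filter≡[]⇒avoids tail≡[]
    ; others-avoid = others }
    where
    others : ∀ j → j ≢ zero → All (∁ P) (cs j)
    others zero    j≢ = contradiction refl j≢
    others (suc j) _  = avoids-concat-tabulate (cs ∘ suc) (filter≡[]⇒avoids tail≡[]) j

-- The four half-edges at a vertex

Distinct : Fin 4 → Fin 4 → Fin 4 → Fin 4 → Set
Distinct a b c d = a ≢ b × a ≢ c × a ≢ d × b ≢ c × b ≢ d × c ≢ d

distinct? : ∀ a b c d → Dec (Distinct a b c d)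
distinct? a b c d =
  ¬? (a ≟ᶠ b) ×-dec ¬? (a ≟ᶠ c) ×-dec ¬? (a ≟ᶠ d) ×-dec ¬? (b ≟ᶠ c) ×-dec ¬? (b ≟ᶠ d) ×-dec ¬? (c ≟ᶠ d)

distinct-swap₂₃ : ∀ {a b c d} → Distinct a b c d → Distinct a c b d
distinct-swap₂₃ (a≢b , a≢c , a≢d , b≢c , b≢d , c≢d) = a≢c , a≢b , a≢d , b≢c ∘ sym , c≢d , b≢d

-- The next four facts are checked by evaluation at every point of Fin 4; they are abstract
-- so that their uses do not re-run the evaluation.
abstract
  distinct-cover : ∀ a b c d → Distinct a b c d → ∀ e → e ≡ a ⊎ e ≡ b ⊎ e ≡ c ⊎ e ≡ d
  distinct-cover = from-yes (all? λ a → all? λ b → all? λ c → all? λ d →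
    distinct? a b c d →-dec all? λ e → e ≟ᶠ a ⊎-dec e ≟ᶠ b ⊎-dec e ≟ᶠ c ⊎-dec e ≟ᶠ d)

  pair-¬cover : ∀ (a b : Fin 4) → ¬ (∀ e → e ≡ a ⊎ e ≡ b)
  pair-¬cover = from-yes (all? λ a → all? λ b → ¬? (all? λ (e : Fin 4) → e ≟ᶠ a ⊎-dec e ≟ᶠ b))

  pairT-complement : ∀ a b c d → Distinct a b c d → pairT c d ≡ pairT a b
  pairT-complement = from-yes (all? λ a → all? λ b → all? λ c → all? λ d →
    distinct? a b c d →-dec pairT c d ≟ᶠ pairT a b)

  pairT-cover : ∀ a b c d → Distinct a b c d → ∀ t → t ≡ pairT a b ⊎ t ≡ pairT a d ⊎ t ≡ pairT a c
  pairT-cover = from-yes (all? λ a → all? λ b → all? λ c → all? λ d →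
    distinct? a b c d →-dec all? λ t → t ≟ᶠ pairT a b ⊎-dec t ≟ᶠ pairT a d ⊎-dec t ≟ᶠ pairT a c)

Even : (Fin 4 → Bool) → Set
Even z = xorFin z ≡ false

across-pairT : ∀ z → Even z → ∀ {x y} → x ≢ y → z zero xor z (suc (pairT x y)) ≡ z x xor z y
across-pairT z even = go
  where
  z₀ = z zero
  z₁ = z (suc zero)
  z₂ = z (suc (suc zero))
  z₃ = z (suc (suc (suc zero)))
  sum≡false : (z₀ xor z₁) xor (z₂ xor z₃) ≡ false
  sum≡false = trans (xor-assoc z₀ z₁ (z₂ xor z₃))
                    (trans (cong (λ w → z₀ xor (z₁ xor (z₂ xor w))) (sym (xor-identityʳ z₃))) even)
  01≡23 : z₀ xor z₁ ≡ z₂ xor z₃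
  01≡23 = xor≡false⇒≡ sum≡false
  02≡13 : z₀ xor z₂ ≡ z₁ xor z₃
  02≡13 = xor≡false⇒≡ (trans (xor-interchange z₀ z₂ z₁ z₃) sum≡false)
  03≡12 : z₀ xor z₃ ≡ z₁ xor z₂
  03≡12 = xor≡false⇒≡ (trans (xor-interchange z₀ z₃ z₁ z₂)
                              (trans (cong ((z₀ xor z₁) xor_) (xor-comm z₃ z₂)) sum≡false))
  go : ∀ {x y} → x ≢ y → z zero xor z (suc (pairT x y)) ≡ z x xor z y
  go {zero}                 {zero}                 x≢y = contradiction refl x≢y
  go {zero}                 {suc zero}             _   = refl
  go {zero}                 {suc (suc zero)}       _   = refl
  go {zero}                 {suc (suc (suc zero))} _   = refl
  go {suc zero}             {zero}                 _   = xor-comm z₀ z₁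
  go {suc zero}             {suc zero}             x≢y = contradiction refl x≢y
  go {suc zero}             {suc (suc zero)}       _   = 03≡12
  go {suc zero}             {suc (suc (suc zero))} _   = 02≡13
  go {suc (suc zero)}       {zero}                 _   = xor-comm z₀ z₂
  go {suc (suc zero)}       {suc zero}             _   = trans 03≡12 (xor-comm z₁ z₂)
  go {suc (suc zero)}       {suc (suc zero)}       x≢y = contradiction refl x≢y
  go {suc (suc zero)}       {suc (suc (suc zero))} _   = 01≡23
  go {suc (suc (suc zero))} {zero}                 _   = xor-comm z₀ z₃
  go {suc (suc (suc zero))} {suc zero}             _   = trans 02≡13 (xor-comm z₁ z₃)
  go {suc (suc (suc zero))} {suc (suc zero)}       _   = trans 01≡23 (xor-comm z₂ z₃)
  go {suc (suc (suc zero))} {suc (suc (suc zero))} x≢y = contradiction refl x≢y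

even-complement : ∀ z → Even z → ∀ {a b c d} → Distinct a b c d → z c xor z d ≡ z a xor z b
even-complement z even {a} {b} {c} {d} dist@(a≢b , _ , _ , _ , _ , c≢d) = begin
  z c xor z d                     ≡⟨ sym (across-pairT z even c≢d) ⟩
  z zero xor z (suc (pairT c d))  ≡⟨ cong (λ t → z zero xor z (suc t)) (pairT-complement a b c d dist) ⟩
  z zero xor z (suc (pairT a b))  ≡⟨ across-pairT z even a≢b ⟩
  z a xor z b                     ∎
  where open ≡-Reasoning

-- The shape of an entry of M(C) at a vertex passed as (a , b) and then as (c , d), with
-- D the entry of the identity matrix and A that of the interlacement matrix.
transition-entry : ∀ {a b c d} → Distinct a b c d → ∀ z → Even z →
  ∀ {D A} → D ≡ z a xor z b → A ≡ z a xor z d → ∀ t →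
  (if t == pairT a b then D else if t == pairT a d then A else if t == pairT a c then D xor A else false)
    ≡ z zero xor z (suc t)
transition-entry {a} {b} {c} {d} dist@(a≢b , a≢c , a≢d , b≢c , b≢d , c≢d) z even refl refl t
  with t ≟ᶠ pairT a b
... | yes refl = sym (across-pairT z even a≢b)
... | no t≢ab with t ≟ᶠ pairT a d
...   | yes refl = sym (across-pairT z even a≢d)
...   | no t≢ad with t ≟ᶠ pairT a c
...     | yes refl = begin
  (z a xor z b) xor (z a xor z d)   ≡⟨ xor-cancelˡ-common (z a) (z b) (z d) ⟩
  z b xor z d                       ≡⟨ sym (across-pairT z even b≢d) ⟩
  z zero xor z (suc (pairT b d))
    ≡⟨ cong (λ s → z zero xor z (suc s)) (pairT-complement a c b d (distinct-swap₂₃ dist)) ⟩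
  z zero xor z (suc (pairT a c))    ∎
  where open ≡-Reasoning
...     | no t≢ac with pairT-cover a b c d dist t
...       | inj₁ t≡ab        = contradiction t≡ab t≢ab
...       | inj₂ (inj₁ t≡ad) = contradiction t≡ad t≢ad
...       | inj₂ (inj₂ t≡ac) = contradiction t≡ac t≢ac

-- Half-edges, walks and cycles

_==ₕ_ : ∀ {n} → HalfEdge n → HalfEdge n → Bool
(v , i) ==ₕ (w , j) = (v == w) ∧ (i == j)

==ₕ-refl : ∀ {n} (h : HalfEdge n) → (h ==ₕ h) ≡ true
==ₕ-refl (v , i) = cong₂ _∧_ (==-refl v) (==-refl i)

==ₕ-≢ : ∀ {n} {h h' : HalfEdge n} → h ≢ h' → (h ==ₕ h') ≡ false
==ₕ-≢ {h = v , i} {w , j} h≢h' with v ≟ᶠ w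
... | yes refl = ==-≢ (h≢h' ∘ cong (v ,_))
... | no _     = refl

==ₕ-involution : ∀ {n} (f : HalfEdge n → HalfEdge n) → (∀ h → f (f h) ≡ h) →
                 ∀ h h' → (h ==ₕ f h') ≡ (f h ==ₕ h')
==ₕ-involution f invol h h' with ≡-dec _≟ᶠ_ _≟ᶠ_ h (f h')
... | yes refl   = trans (==ₕ-refl (f h')) (sym (trans (cong (_==ₕ h') (invol h')) (==ₕ-refl h')))
... | no h≢fh'   = trans (==ₕ-≢ h≢fh') (sym (==ₕ-≢ λ fh≡h' → h≢fh' (trans (sym (invol h)) (cong f fh≡h'))))

xorFin-==ₕ : ∀ {n} (h : HalfEdge n) w → xorFin (λ i → h ==ₕ (w , i)) ≡ (proj₁ h == w)
xorFin-==ₕ (v , j) w =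
  trans (xorFin-∧ (v == w) (j ==_))
        (trans (cong ((v == w) ∧_) (xorFin-select (λ _ → true) j)) (∧-identityʳ (v == w)))

parity-∉ : ∀ {n} {h : HalfEdge n} {L} → h ∉ L → parity (_==ₕ h) L ≡ false
parity-∉ h∉L = parity-false (All.tabulate λ h'∈L → ==ₕ-≢ λ h'≡h → h∉L (subst (_∈ _) h'≡h h'∈L))

parity-∈ : ∀ {n} {h : HalfEdge n} {L} → Unique L → h ∈ L → parity (_==ₕ h) L ≡ true
parity-∈ {h = h} (h∉L ∷ _) (here refl) =
  cong₂ _xor_ (==ₕ-refl h) (parity-∉ λ h∈L → All.lookup h∉L h∈L refl)
parity-∈ {h = h} {e ∷ _} (e∉L ∷ unique) (there h∈L) =
  cong₂ _xor_ (==ₕ-≢ {h = e} {h} λ { refl → All.lookup e∉L h∈L refl }) (parity-∈ unique h∈L)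

-- The cycle space of F, an edge set being represented by its indicator function on half-edges.
record IsCycle {n} (F : FourRegular n) (z : HalfEdge n → Bool) : Set where
  field
    σ-invariant : ∀ h → z (σ F h) ≡ z h
    even        : ∀ v → Even (λ i → z (v , i))

across : ∀ {n} → (HalfEdge n → Bool) → Tr n → Bool
across z (v , t) = z (v , zero) xor z (v , suc t)

entry exit : ∀ {n} → Passage n → HalfEdge n
entry (v , a , b) = v , a
exit  (v , a , b) = v , b

halvesOf : ∀ {n} → List (Passage n) → List (HalfEdge n)
halvesOf = concatMap halves

traversed : ∀ {n} → List (Passage n) → List (HalfEdge n)
traversed (p ∷ q ∷ ps) = exit p ∷ entry q ∷ traversed (q ∷ ps)
traversed _            = []

traversed-segment : ∀ {n} (p : Passage n) ps q →
                    traversed (p ∷ ps ++ q ∷ []) ≡ exit p ∷ halvesOf ps ++ entry q ∷ []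
traversed-segment p []       q = refl
traversed-segment p (r ∷ ps) q = cong (λ l → exit p ∷ entry r ∷ l) (traversed-segment r ps q)

traversed-vertexParity : ∀ {n} (p : Passage n) ps q w →
  parity (λ h → proj₁ h == w) (traversed (p ∷ ps ++ q ∷ [])) ≡ (pv p == w) xor (pv q == w)
traversed-vertexParity p []       q w = cong ((pv p == w) xor_) (xor-identityʳ (pv q == w))
traversed-vertexParity p (r ∷ ps) q w = begin
  (pv p == w) xor ((pv r == w) xor parity (λ h → proj₁ h == w) (traversed (r ∷ ps ++ q ∷ [])))
    ≡⟨ cong (λ s → (pv p == w) xor ((pv r == w) xor s)) (traversed-vertexParity r ps q w) ⟩
  (pv p == w) xor ((pv r == w) xor ((pv r == w) xor (pv q == w)))
    ≡⟨ cong ((pv p == w) xor_) (trans (sym (xor-assoc (pv r == w) _ _))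
                                      (cong (_xor (pv q == w)) (xor-same (pv r == w)))) ⟩
  (pv p == w) xor (pv q == w) ∎
  where open ≡-Reasoning

module _ {n} (F : FourRegular n) where

  traversed-σ : ∀ {l} → Chain F l → ∀ h → parity (_==ₕ σ F h) (traversed l) ≡ parity (_==ₕ h) (traversed l)
  traversed-σ {[]}         _               h = refl
  traversed-σ {p ∷ []}     _               h = refl
  traversed-σ {p ∷ q ∷ ps} (link , chain) h = begin
    (exit p ==ₕ σ F h) xor ((entry q ==ₕ σ F h) xor parity (_==ₕ σ F h) (traversed (q ∷ ps)))
      ≡⟨ cong₂ _xor_ exit-step (cong₂ _xor_ entry-step (traversed-σ chain h)) ⟩
    (entry q ==ₕ h) xor ((exit p ==ₕ h) xor parity (_==ₕ h) (traversed (q ∷ ps)))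
      ≡⟨ xor-exchange (entry q ==ₕ h) (exit p ==ₕ h) _ ⟩
    (exit p ==ₕ h) xor ((entry q ==ₕ h) xor parity (_==ₕ h) (traversed (q ∷ ps))) ∎
    where
    open ≡-Reasoning
    swap = ==ₕ-involution (σ F) (σ-invol F)
    exit-step : (exit p ==ₕ σ F h) ≡ (entry q ==ₕ h)
    exit-step = trans (swap (exit p) h) (cong (_==ₕ h) link)
    entry-step : (entry q ==ₕ σ F h) ≡ (exit p ==ₕ h)
    entry-step = trans (swap (entry q) h) (cong (_==ₕ h) (trans (cong (σ F) (sym link)) (σ-invol F (exit p))))

  chain-prefix : ∀ xs ys → Chain F (xs ++ ys) → Chain F xs
  chain-prefix []           ys _              = _
  chain-prefix (p ∷ [])     ys _              = _
  chain-prefix (p ∷ q ∷ xs) ys (link , chain) = link , chain-prefix (q ∷ xs) ys chain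

  chain-suffix : ∀ xs ys → Chain F (xs ++ ys) → Chain F ys
  chain-suffix []           ys chain       = chain
  chain-suffix (p ∷ [])     []       _     = _
  chain-suffix (p ∷ [])     (q ∷ ys) (_ , chain) = chain
  chain-suffix (p ∷ q ∷ xs) ys (_ , chain) = chain-suffix (q ∷ xs) ys chain

  closedWalk-chain : ∀ l → ClosedWalk F l → Chain F l
  closedWalk-chain (p ∷ ps) closed = chain-prefix (p ∷ ps) (p ∷ []) closed

halvesOf-split : ∀ {n} (xs : List (Passage n)) x ys y zs →
  halvesOf (xs ++ x ∷ ys ++ y ∷ zs) ≡ halvesOf xs ++ entry x ∷ exit x ∷ halvesOf ys ++ entry y ∷ exit y ∷ halvesOf zs
halvesOf-split xs x ys y zs =
  trans (concatMap-++ halves xs (x ∷ ys ++ y ∷ zs))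
        (cong (λ l → halvesOf xs ++ entry x ∷ exit x ∷ l) (concatMap-++ halves ys (y ∷ zs)))

∈-halvesOf⁺ : ∀ {n} {p : Passage n} {Q} → p ∈ Q → entry p ∈ halvesOf Q × exit p ∈ halvesOf Q
∈-halvesOf⁺ (here refl)  = here refl , there (here refl)
∈-halvesOf⁺ {Q = q ∷ Q} (there p∈Q) with ∈-halvesOf⁺ p∈Q
... | entry∈ , exit∈ = there (there entry∈) , there (there exit∈)

∈-halvesOf⁻ : ∀ {n} {h : HalfEdge n} Q → h ∈ halvesOf Q → ∃ λ p → p ∈ Q × (h ≡ entry p ⊎ h ≡ exit p)
∈-halvesOf⁻ (q ∷ Q) (here h≡)         = q , here refl , inj₁ h≡
∈-halvesOf⁻ (q ∷ Q) (there (here h≡)) = q , here refl , inj₂ h≡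
∈-halvesOf⁻ (q ∷ Q) (there (there h∈)) with ∈-halvesOf⁻ Q h∈
... | p , p∈Q , h≡ = p , there p∈Q , h≡

Apart : ∀ {n} → Passage n → Passage n → Set
Apart x y = entry x ≢ exit x × entry x ≢ entry y × entry x ≢ exit y ×
            exit x ≢ entry y × exit x ≢ exit y × entry y ≢ exit y

apart : ∀ {n} (xs : List (Passage n)) x ys y zs → Unique (halvesOf (xs ++ x ∷ ys ++ y ∷ zs)) → Apart x y
apart xs x ys y zs unique
  with unique-++⁻ (halvesOf xs) (subst Unique (halvesOf-split xs x ys y zs) unique)
... | _ , (entry∉ ∷ exit∉ ∷ rest) , _ with unique-++⁻ (halvesOf ys) rest
...   | _ , (entry-y∉ ∷ _) , _ =
  All.lookup entry∉ (here refl) ,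
  All.lookup entry∉ (there (∈-++⁺ʳ (halvesOf ys) (here refl))) ,
  All.lookup entry∉ (there (∈-++⁺ʳ (halvesOf ys) (there (here refl)))) ,
  All.lookup exit∉ (∈-++⁺ʳ (halvesOf ys) (here refl)) ,
  All.lookup exit∉ (∈-++⁺ʳ (halvesOf ys) (there (here refl))) ,
  All.lookup entry-y∉ (here refl)

apart⇒distinct : ∀ {n} {v : Fin n} {a b c d} → Apart (v , a , b) (v , c , d) → Distinct a b c d
apart⇒distinct {v = v} (ab , ac , ad , bc , bd , cd) =
  ab ∘ cong (v ,_) , ac ∘ cong (v ,_) , ad ∘ cong (v ,_) , bc ∘ cong (v ,_) , bd ∘ cong (v ,_) , cd ∘ cong (v ,_)

-- Interlacement

anyFin-false : ∀ {m} (f : Fin m → Bool) → (∀ i → f i ≡ false) → anyFin f ≡ false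
anyFin-false {zero}  f f≡0 = refl
anyFin-false {suc m} f f≡0 = cong₂ _∨_ (f≡0 zero) (anyFin-false (f ∘ suc) (f≡0 ∘ suc))

anyFin-only : ∀ {m} (f : Fin m → Bool) k → (∀ i → i ≢ k → f i ≡ false) → anyFin f ≡ f k
anyFin-only f zero    others =
  trans (cong (f zero ∨_) (anyFin-false (f ∘ suc) λ i → others (suc i) λ ())) (∨-identityʳ (f zero))
anyFin-only f (suc k) others =
  trans (cong (_∨ anyFin (f ∘ suc)) (others zero λ ()))
        (anyFin-only (f ∘ suc) k λ i i≢k → others (suc i) (i≢k ∘ suc-injective))

is? : ∀ {n} (v : Fin n) → Decidable (_≡ v)
is? v x = x ≟ᶠ v

filter-two-visits : ∀ {n} {v : Fin n} X Y Z → All (_≢ v) X → All (_≢ v) Y → All (_≢ v) Z →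
                    filter (is? v) (X ++ v ∷ Y ++ v ∷ Z) ≡ v ∷ v ∷ []
filter-two-visits {v = v} X Y Z X-avoids Y-avoids Z-avoids = begin
  filter (is? v) (X ++ v ∷ Y ++ v ∷ Z)
    ≡⟨ filter-++ (is? v) X _ ⟩
  filter (is? v) X ++ filter (is? v) (v ∷ Y ++ v ∷ Z)
    ≡⟨ cong₂ _++_ (filter-none (is? v) X-avoids) (filter-accept (is? v) refl) ⟩
  v ∷ filter (is? v) (Y ++ v ∷ Z)
    ≡⟨ cong (v ∷_) (filter-++ (is? v) Y _) ⟩
  v ∷ filter (is? v) Y ++ filter (is? v) (v ∷ Z)
    ≡⟨ cong (λ l → v ∷ l ++ _) (filter-none (is? v) Y-avoids) ⟩
  v ∷ filter (is? v) (v ∷ Z)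
    ≡⟨ cong (v ∷_) (filter-accept (is? v) refl) ⟩
  v ∷ v ∷ filter (is? v) Z
    ≡⟨ cong (λ l → v ∷ v ∷ l) (filter-none (is? v) Z-avoids) ⟩
  v ∷ v ∷ [] ∎
  where open ≡-Reasoning

module _ {n} {u v : Fin n} where

  is-u-or-v? : Decidable (λ x → x ≡ u ⊎ x ≡ v)
  is-u-or-v? x = (x ≟ᶠ u) ⊎-dec (x ≟ᶠ v)

  interlacedOn-avoiding : ∀ l → All (_≢ u) l → interlacedOn u v l ≡ false
  interlacedOn-avoiding l avoids = no-alternation (filter is-u-or-v? l) (All.filter⁺ is-u-or-v? avoids)
    where
    no-alternation : ∀ l' → All (_≢ u) l' → (alternates u v l' ∨ alternates v u l') ≡ false
    no-alternation (x ∷ y ∷ z ∷ w ∷ []) (x≢u ∷ y≢u ∷ _) rewrite ==-≢ x≢u | ==-≢ y≢u = ∧-zeroʳ (x == v)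
    no-alternation []                    _ = refl
    no-alternation (_ ∷ [])              _ = refl
    no-alternation (_ ∷ _ ∷ [])          _ = refl
    no-alternation (_ ∷ _ ∷ _ ∷ [])      _ = refl
    no-alternation (_ ∷ _ ∷ _ ∷ _ ∷ _ ∷ _) _ = refl

  module _ (u≢v : u ≢ v) where

    private
      filter-avoiding : ∀ W → All (_≢ u) W → filter is-u-or-v? W ≡ filter (is? v) W
      filter-avoiding []      []               = refl
      filter-avoiding (w ∷ W) (w≢u ∷ avoids) with w ≟ᶠ u | w ≟ᶠ v
      ... | yes w≡u | _     = contradiction w≡u w≢u
      ... | no _    | yes _ = cong (w ∷_) (filter-avoiding W avoids)
      ... | no _    | no _  = filter-avoiding W avoids

      uu : (u == u) ≡ true
      uu = ==-refl u
      vv : (v == v) ≡ true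
      vv = ==-refl v
      uv : (u == v) ≡ false
      uv = ==-≢ u≢v
      vu : (v == u) ≡ false
      vu = ==-≢ (u≢v ∘ sym)

      -- A, B and C are the occurrences of v before, between and after the two occurrences of u.
      alternation : ∀ A B C → (A ++ B ++ C ≡ [] ⊎ A ++ B ++ C ≡ v ∷ v ∷ []) →
        (alternates u v (A ++ u ∷ B ++ u ∷ C) ∨ alternates v u (A ++ u ∷ B ++ u ∷ C)) ≡ parity (_== v) B
      alternation A B C (inj₁ none)
        with ++-conicalˡ A _ none | ++-conicalˡ B C (++-conicalʳ A _ none) | ++-conicalʳ B C (++-conicalʳ A _ none)
      ... | refl | refl | refl = refl
      alternation A B C (inj₂ two) with ++≡pair A (B ++ C) two
      ... | inj₁ (refl , BC) with ++≡pair B C BC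
      ...   | inj₁ (refl , refl)        rewrite uu | vv | uv = refl
      ...   | inj₂ (inj₁ (refl , refl)) rewrite uu | vv = refl
      ...   | inj₂ (inj₂ (refl , refl)) rewrite uu | vv | uv | vu = refl
      alternation A B C (inj₂ two) | inj₂ (inj₁ (refl , BC)) with ++≡[ v ] B C BC
      ...   | inj₁ (refl , refl)        rewrite uu | vv | uv | vu = refl
      ...   | inj₂ (refl , refl)        rewrite uu | vv | uv | vu = refl
      alternation A B C (inj₂ two) | inj₂ (inj₂ (refl , BC))
        with ++-conicalˡ B C BC | ++-conicalʳ B C BC
      ... | refl | refl rewrite uu | vv | uv | vu = refl

    interlacedOn-split : ∀ X Y Z → All (_≢ u) X → All (_≢ u) Y → All (_≢ u) Z →
      (filter (is? v) (X ++ u ∷ Y ++ u ∷ Z) ≡ [] ⊎ filter (is? v) (X ++ u ∷ Y ++ u ∷ Z) ≡ v ∷ v ∷ []) →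
      interlacedOn u v (X ++ u ∷ Y ++ u ∷ Z) ≡ parity (_== v) Y
    interlacedOn-split X Y Z X-avoids Y-avoids Z-avoids count = begin
      interlacedOn u v (X ++ u ∷ Y ++ u ∷ Z)
        ≡⟨ cong (λ l → alternates u v l ∨ alternates v u l) uv-split ⟩
      alternates u v (fX ++ u ∷ fY ++ u ∷ fZ) ∨ alternates v u (fX ++ u ∷ fY ++ u ∷ fZ)
        ≡⟨ alternation fX fY fZ (Sum.map (trans (sym v-split)) (trans (sym v-split)) count) ⟩
      parity (_== v) fY
        ≡⟨ parity-filter (is? v) (_== v) (λ _ → ==-≢) Y ⟩
      parity (_== v) Y ∎
      where
      open ≡-Reasoning
      fX = filter (is? v) X
      fY = filter (is? v) Y
      fZ = filter (is? v) Z
      accept-u : ∀ W → filter is-u-or-v? (u ∷ W) ≡ u ∷ filter is-u-or-v? W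
      accept-u W = filter-accept is-u-or-v? (inj₁ refl)
      uv-split : filter is-u-or-v? (X ++ u ∷ Y ++ u ∷ Z) ≡ fX ++ u ∷ fY ++ u ∷ fZ
      uv-split = trans (filter-++ is-u-or-v? X _) (cong₂ _++_ (filter-avoiding X X-avoids)
        (trans (accept-u _) (cong (u ∷_) (trans (filter-++ is-u-or-v? Y _) (cong₂ _++_ (filter-avoiding Y Y-avoids)
          (trans (accept-u Z) (cong (u ∷_) (filter-avoiding Z Z-avoids))))))))
      v-split : filter (is? v) (X ++ u ∷ Y ++ u ∷ Z) ≡ fX ++ fY ++ fZ
      v-split = trans (filter-++ (is? v) X _) (cong (fX ++_)
        (trans (filter-reject (is? v) u≢v) (trans (filter-++ (is? v) Y _) (cong (fY ++_) (filter-reject (is? v) u≢v)))))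

-- Euler systems

module EulerSystemStructure {n} {F : FourRegular n} {C : EulerSystem n} (E : IsEulerSystem F C) where
  open IsEulerSystem E

  at? : ∀ v → Decidable (λ (p : Passage n) → pv p ≡ v)
  at? v p = pv p ≟ᶠ v

  incident-passage : ∀ v i → ∃ λ p → p ∈ passagesAt C v × ((v , i) ≡ entry p ⊎ (v , i) ≡ exit p)
  incident-passage v i with ∈-halvesOf⁻ (allPassages C) (covering (v , i))
  ... | p , p∈ , incident =
    p , ∈-filter⁺ (at? v) p∈ (sym ([ cong proj₁ , cong proj₁ ]′ incident)) , incident

  same-circuit : ∀ v i j {p q} → p ∈ circ C i → pv p ≡ v → q ∈ circ C j → pv q ≡ v → i ≡ j
  same-circuit v i j {p} p∈ refl q∈ pq≡ =
    oneEach i j (pv p) (pv p) (∈-map⁺ pv p∈) (subst (_∈ map pv (circ C j)) pq≡ (∈-map⁺ pv q∈)) ε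

  passages-apart : ∀ xs x ys y zs → allPassages C ≡ xs ++ x ∷ ys ++ y ∷ zs → Apart x y
  passages-apart xs x ys y zs split = apart xs x ys y zs (subst (Unique ∘ halvesOf) split unique)

  -- One passage would leave a half-edge at v unused, three would use six different ones.
  two-passages : ∀ v → ∃ λ x → ∃ λ y → passagesAt C v ≡ x ∷ y ∷ []
  two-passages v with passagesAt C v in eq
  ... | [] with incident-passage v zero
  ...   | p , p∈ , _ = contradiction (subst (p ∈_) eq p∈) λ ()
  two-passages v | x ∷ [] = contradiction covered (pair-¬cover (proj₁ (proj₂ x)) (proj₂ (proj₂ x)))
    where
    covered : ∀ i → i ≡ proj₁ (proj₂ x) ⊎ i ≡ proj₂ (proj₂ x)
    covered i with incident-passage v i
    ... | p , p∈ , incident with subst (p ∈_) eq p∈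
    ...   | here refl = Sum.map (cong proj₂) (cong proj₂) incident
  two-passages v | x ∷ y ∷ [] = x , y , refl
  two-passages v | (_ , a , b) ∷ (_ , c , d) ∷ (_ , e , f) ∷ _
    with filter≡triple (at? v) eq
  ... | xs , ys , zs , ws , split , refl , refl , refl
    with passages-apart xs x ys y (zs ++ w ∷ ws) split
       | passages-apart xs x (ys ++ y ∷ zs) w ws
           (trans split (cong (λ l → xs ++ x ∷ l) (sym (++-assoc ys (y ∷ zs) (w ∷ ws)))))
       | passages-apart (xs ++ x ∷ ys) y zs w ws (trans split (sym (++-assoc xs (x ∷ ys) (y ∷ zs ++ w ∷ ws))))
    where
    x = (v , a , b)
    y = (v , c , d)
    w = (v , e , f)
  ... | x-y | (_ , xe , _ , ye , _) | (_ , ye' , _ , ze , _) with distinct-cover a b c d (apart⇒distinct x-y) e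
  ...   | inj₁ refl               = contradiction refl xe
  ...   | inj₂ (inj₁ refl)        = contradiction refl ye
  ...   | inj₂ (inj₂ (inj₁ refl)) = contradiction refl ye'
  ...   | inj₂ (inj₂ (inj₂ refl)) = contradiction refl ze

  record Visit (v : Fin n) : Set where
    field
      a b c d  : Fin 4
      passages : passagesAt C v ≡ (v , a , b) ∷ (v , c , d) ∷ []
      distinct : Distinct a b c d
      located  : LocalisedHits (at? v) (circ C) (v , a , b) (v , c , d)

    first second : Passage n
    first  = v , a , b
    second = v , c , d

    open LocalisedHits located public
    open TwoHits hits public

    outside-before outside-after : List (Passage n)
    outside-before = preceding ++ before
    outside-after  = after ++ following

    outside-before-avoids : All (λ p → pv p ≢ v) outside-before
    outside-before-avoids = All.++⁺ preceding-avoids before-avoids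

    outside-after-avoids : All (λ p → pv p ≢ v) outside-after
    outside-after-avoids = All.++⁺ after-avoids following-avoids

    global-split : allPassages C ≡ outside-before ++ first ∷ between ++ second ∷ outside-after
    global-split = trans whole (trans (cong (λ l → preceding ++ l ++ following) split)
                                      (++-regroup preceding before first between second after following))

    first∈ : first ∈ allPassages C
    first∈ = subst (first ∈_) (sym global-split) (∈-++⁺ʳ outside-before (here refl))

    second∈ : second ∈ allPassages C
    second∈ = subst (second ∈_) (sym global-split) (∈-++⁺ʳ outside-before (there (∈-++⁺ʳ between (here refl))))

    segment-chain : Chain F (first ∷ between ++ second ∷ [])
    segment-chain = chain-prefix F (first ∷ between ++ second ∷ []) after
      (subst (Chain F) (cong (first ∷_) (sym (++-assoc between (second ∷ []) after)))
        (chain-suffix F before _ (subst (Chain F) split (closedWalk-chain F _ (closed index)))))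

  -- Abstract: M-at rewrites with the field passages, which fails once visit unfolds.
  abstract
    visit : ∀ v → Visit v
    visit v with two-passages v
    ... | x , y , eq
      with ∈-filter⁻ (at? v) {xs = allPassages C} (subst (x ∈_) (sym eq) (here refl))
         | ∈-filter⁻ (at? v) {xs = allPassages C} (subst (y ∈_) (sym eq) (there (here refl)))
    visit v | (_ , a , b) , (_ , c , d) , eq | _ , refl | _ , refl = record
      { a = a ; b = b ; c = c ; d = d
      ; passages = eq
      ; distinct = apart⇒distinct (passages-apart before _ between _ after split)
      ; located  = localise (at? v) (circ C) (same-circuit v) eq }
      where open TwoHits (filter≡pair (at? v) {allPassages C} eq)

  module At (v : Fin n) = Visit (visit v)

  segment : Fin n → List (Passage n)
  segment u = At.first u ∷ At.between u ++ At.second u ∷ []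

  loop : Fin n → HalfEdge n → Bool
  loop u h = parity (_==ₕ h) (traversed (segment u))

  loop-σ : ∀ u h → loop u (σ F h) ≡ loop u h
  loop-σ u = traversed-σ F (At.segment-chain u)

  loop-even : ∀ u w → Even (λ i → loop u (w , i))
  loop-even u w = begin
    xorFin (λ i → parity (_==ₕ (w , i)) T)
      ≡⟨ xorFin-parity (λ i h → h ==ₕ (w , i)) T ⟩
    parity (λ h → xorFin (λ i → h ==ₕ (w , i))) T
      ≡⟨ parity-cong {l = T} (All.tabulate λ {h} _ → xorFin-==ₕ h w) ⟩
    parity (λ h → proj₁ h == w) T
      ≡⟨ traversed-vertexParity (At.first u) (At.between u) (At.second u) w ⟩
    (u == w) xor (u == w)
      ≡⟨ xor-same (u == w) ⟩
    false ∎
    where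
    open ≡-Reasoning
    T = traversed (segment u)

  module Loop (u : Fin n) where
    open At u

    private
      S = traversed (segment u)

      S≡ : S ≡ exit first ∷ halvesOf between ++ entry second ∷ []
      S≡ = traversed-segment first between second

      halves-split : halvesOf (allPassages C) ≡
                     halvesOf outside-before ++ entry first ∷ S ++ exit second ∷ halvesOf outside-after
      halves-split = trans (cong halvesOf global-split)
        (trans (halvesOf-split outside-before first between second outside-after)
          (cong (λ l → halvesOf outside-before ++ entry first ∷ l)
            (trans (sym (++-assoc (exit first ∷ halvesOf between) (entry second ∷ []) _))
                   (cong (_++ exit second ∷ halvesOf outside-after) (sym S≡)))))

      outer = unique-++⁻ (halvesOf outside-before) (subst Unique halves-split unique)
      inner = unique-++⁻ S {exit second ∷ halvesOf outside-after} (AllPairs.tail (proj₁ (proj₂ outer)))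

      inside : ∀ {h} → h ∈ S → loop u h ≡ true
      inside = parity-∈ (proj₁ inner)

      outside : ∀ {h} → h ∉ S → loop u h ≡ false
      outside = parity-∉ {L = S}

      on-between : ∀ {p} → p ∈ between → loop u (entry p) ≡ true × loop u (exit p) ≡ true
      on-between {p} p∈ with ∈-halvesOf⁺ p∈
      ... | entry∈ , exit∈ = inside (subst (entry p ∈_) (sym S≡) (there (∈-++⁺ˡ entry∈))) ,
                             inside (subst (exit p ∈_) (sym S≡) (there (∈-++⁺ˡ exit∈)))

      off-entry-first : loop u (entry first) ≡ false
      off-entry-first = outside λ h∈S → All.lookup (AllPairs.head (proj₁ (proj₂ outer))) (∈-++⁺ˡ h∈S) refl

      off-exit-second : loop u (exit second) ≡ false
      off-exit-second = outside λ h∈S → proj₂ (proj₂ inner) h∈S (here refl)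

      off-before : ∀ {p} → p ∈ outside-before → loop u (entry p) ≡ false × loop u (exit p) ≡ false
      off-before p∈ with ∈-halvesOf⁺ p∈
      ... | entry∈ , exit∈ = outside (λ h∈S → proj₂ (proj₂ outer) entry∈ (there (∈-++⁺ˡ h∈S))) ,
                             outside (λ h∈S → proj₂ (proj₂ outer) exit∈ (there (∈-++⁺ˡ h∈S)))

      off-after : ∀ {p} → p ∈ outside-after → loop u (entry p) ≡ false × loop u (exit p) ≡ false
      off-after p∈ with ∈-halvesOf⁺ p∈
      ... | entry∈ , exit∈ = outside (λ h∈S → proj₂ (proj₂ inner) h∈S (there entry∈)) ,
                             outside (λ h∈S → proj₂ (proj₂ inner) h∈S (there exit∈))

      on-exit-first : loop u (exit first) ≡ true
      on-exit-first = inside (subst (exit first ∈_) (sym S≡) (here refl))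

      on-entry-second : loop u (entry second) ≡ true
      on-entry-second = inside (subst (entry second ∈_) (sym S≡) (there (∈-++⁺ʳ (halvesOf between) (here refl))))

    loop-step : ∀ {p} → p ∈ allPassages C → loop u (entry p) xor loop u (exit p) ≡ (pv p == u)
    loop-step = All.lookup (subst (All Step) (sym global-split)
      (All.++⁺ (All.tabulate λ p∈ → off-step (off-before p∈) (All.lookup outside-before-avoids p∈))
        (at-first ∷ All.++⁺ (All.tabulate λ p∈ → on-step (on-between p∈) (All.lookup between-avoids p∈))
          (at-second ∷ All.tabulate λ p∈ → off-step (off-after p∈) (All.lookup outside-after-avoids p∈)))))
      where
      Step : Passage n → Set
      Step p = loop u (entry p) xor loop u (exit p) ≡ (pv p == u)
      off-step : ∀ {p} → loop u (entry p) ≡ false × loop u (exit p) ≡ false → pv p ≢ u → Step p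
      off-step (entry≡ , exit≡) p≢u = trans (cong₂ _xor_ entry≡ exit≡) (sym (==-≢ p≢u))
      on-step : ∀ {p} → loop u (entry p) ≡ true × loop u (exit p) ≡ true → pv p ≢ u → Step p
      on-step (entry≡ , exit≡) p≢u = trans (cong₂ _xor_ entry≡ exit≡) (sym (==-≢ p≢u))
      at-first : Step first
      at-first = trans (cong₂ _xor_ off-entry-first on-exit-first) (sym (==-refl u))
      at-second : Step second
      at-second = trans (cong₂ _xor_ on-entry-second off-exit-second) (sym (==-refl u))

    loop-entries : ∀ v → parity (λ p → loop u (entry p) ∧ (pv p == v)) (allPassages C) ≡
                         parity (λ p → pv p == v) between xor (u == v)
    loop-entries v = begin
      parity f (allPassages C)
        ≡⟨ cong (parity f) global-split ⟩
      parity f (outside-before ++ first ∷ between ++ second ∷ outside-after)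
        ≡⟨ parity-split f outside-before first between second outside-after ⟩
      parity f outside-before xor (f first xor (parity f between xor (f second xor parity f outside-after)))
        ≡⟨ cong₂ (λ s t → s xor (f first xor t))
             (parity-false (All.tabulate λ p∈ → cong (_∧ _) (proj₁ (off-before p∈))))
             (cong₂ (λ s t → s xor (f second xor t))
               (parity-cong (All.tabulate λ p∈ → cong (_∧ _) (proj₁ (on-between p∈))))
               (parity-false (All.tabulate λ p∈ → cong (_∧ _) (proj₁ (off-after p∈))))) ⟩
      false xor (f first xor (parity (λ p → pv p == v) between xor (f second xor false)))
        ≡⟨ cong₂ (λ s t → s xor (parity (λ p → pv p == v) between xor t))
             (cong (_∧ _) off-entry-first) (trans (xor-identityʳ _) (cong (_∧ _) on-entry-second)) ⟩
      parity (λ p → pv p == v) between xor (u == v) ∎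
      where
      open ≡-Reasoning
      f : Passage n → Bool
      f p = loop u (entry p) ∧ (pv p == v)

  open Loop using (loop-step; loop-entries)

  entries-at : ∀ (f : HalfEdge n → Bool) v →
               parity (λ p → f (entry p) ∧ (pv p == v)) (allPassages C) ≡ f (v , At.a v) xor f (v , At.c v)
  entries-at f v = begin
    parity g (allPassages C)
      ≡⟨ cong (parity g) global-split ⟩
    parity g (outside-before ++ first ∷ between ++ second ∷ outside-after)
      ≡⟨ parity-split g outside-before first between second outside-after ⟩
    parity g outside-before xor (g first xor (parity g between xor (g second xor parity g outside-after)))
      ≡⟨ cong₂ (λ s t → s xor (g first xor t)) (vanish outside-before-avoids)
               (cong₂ (λ s t → s xor (g second xor t)) (vanish between-avoids) (vanish outside-after-avoids)) ⟩
    g first xor (g second xor false)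
      ≡⟨ cong₂ _xor_ (at-v (At.a v)) (trans (xor-identityʳ (g second)) (at-v (At.c v))) ⟩
    f (v , At.a v) xor f (v , At.c v) ∎
    where
    open ≡-Reasoning
    open At v
    g : Passage n → Bool
    g p = f (entry p) ∧ (pv p == v)
    vanish : ∀ {l} → All (λ p → pv p ≢ v) l → parity g l ≡ false
    vanish avoids = parity-false (All.map (λ p≢v → trans (cong (_ ∧_) (==-≢ p≢v)) (∧-zeroʳ _)) avoids)
    at-v : ∀ i → f (v , i) ∧ (v == v) ≡ f (v , i)
    at-v i = trans (cong (f (v , i) ∧_) (==-refl v)) (∧-identityʳ (f (v , i)))

  interlaced-between : ∀ u v → interlaced C u v ≡ parity (λ p → pv p == v) (At.between u)
  interlaced-between u v with u ≟ᶠ v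
  ... | yes refl = sym (parity-false (All.map ==-≢ (At.between-avoids u)))
  ... | no u≢v = begin
    anyFin on-circuit                               ≡⟨ anyFin-only on-circuit index off-circuit ⟩
    interlacedOn u v (map pv (circ C index))            ≡⟨ cong (interlacedOn u v) vertices ⟩
    interlacedOn u v (map pv before ++ u ∷ map pv between ++ u ∷ map pv after)
      ≡⟨ interlacedOn-split u≢v (map pv before) (map pv between) (map pv after)
           (All.map⁺ before-avoids) (All.map⁺ between-avoids) (All.map⁺ after-avoids)
           (subst (λ l → filter (is? v) l ≡ [] ⊎ filter (is? v) l ≡ v ∷ v ∷ []) vertices v-count) ⟩
    parity (_== v) (map pv between)                 ≡⟨ parity-map (_== v) pv between ⟩
    parity (λ p → pv p == v) between                ∎
    where
    open ≡-Reasoning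
    open At u
    on-circuit : Fin (EulerSystem.k C) → Bool
    on-circuit i = interlacedOn u v (map pv (circ C i))
    off-circuit : ∀ i → i ≢ index → on-circuit i ≡ false
    off-circuit i i≢index = interlacedOn-avoiding (map pv (circ C i)) (All.map⁺ (others-avoid i i≢index))
    map-split : ∀ (xs : List (Passage n)) x ys y zs →
                map pv (xs ++ x ∷ ys ++ y ∷ zs) ≡ map pv xs ++ pv x ∷ map pv ys ++ pv y ∷ map pv zs
    map-split xs x ys y zs = trans (map-++ pv xs _) (cong (λ l → map pv xs ++ pv x ∷ l) (map-++ pv ys _))
    vertices : map pv (circ C index) ≡ map pv before ++ u ∷ map pv between ++ u ∷ map pv after
    vertices = trans (cong (map pv) split) (map-split before first between second after)
    v-count : filter (is? v) (map pv (circ C index)) ≡ [] ⊎ filter (is? v) (map pv (circ C index)) ≡ v ∷ v ∷ []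
    v-count with At.index v ≟ᶠ index
    ... | no  index'≢ = inj₁ (filter-none (is? v) (All.map⁺ (At.others-avoid v index (index'≢ ∘ sym))))
    ... | yes same = inj₂ (subst (λ i → filter (is? v) (map pv (circ C i)) ≡ v ∷ v ∷ []) same
      (subst (λ l → filter (is? v) l ≡ v ∷ v ∷ [])
      (sym (trans (cong (map pv) (At.split v)) (map-split (At.before v) _ (At.between v) _ (At.after v))))
      (filter-two-visits (map pv (At.before v)) (map pv (At.between v)) (map pv (At.after v))
        (All.map⁺ (At.before-avoids v)) (All.map⁺ (At.between-avoids v)) (All.map⁺ (At.after-avoids v)))))

  loop-cycle : ∀ u → IsCycle F (loop u)
  loop-cycle u = record { σ-invariant = loop-σ u ; even = loop-even u }

  M-at : ∀ u v t → M C u (v , t) ≡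
    (if t == pairT (At.a v) (At.b v) then δ u v
     else if t == pairT (At.a v) (At.d v) then interlaced C u v
     else if t == pairT (At.a v) (At.c v) then δ u v xor interlaced C u v else false)
  M-at u v t rewrite At.passages v = refl

  row-formula : ∀ u c → M C u c ≡ across (loop u) c
  row-formula u (v , t) =
    trans (M-at u v t) (transition-entry (At.distinct v) (λ i → loop u (v , i)) (loop-even u v) δ≡ interlaced≡ t)
    where
    open At v
    l : Fin 4 → Bool
    l i = loop u (v , i)
    δ≡ : δ u v ≡ l a xor l b
    δ≡ = sym (trans (loop-step u first∈) (==-sym v u))
    interlaced≡ : interlaced C u v ≡ l a xor l d
    interlaced≡ = begin
      interlaced C u v                                              ≡⟨ interlaced-between u v ⟩
      parity (λ p → pv p == v) (At.between u)                       ≡⟨ sym (xor-cancelʳ _ (u == v)) ⟩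
      (parity (λ p → pv p == v) (At.between u) xor (u == v)) xor (u == v)
        ≡⟨ cong₂ _xor_ (trans (sym (loop-entries u v)) (entries-at (loop u) v))
                       (trans (==-sym u v) (sym (loop-step u second∈))) ⟩
      (l a xor l c) xor (l c xor l d)                               ≡⟨ sym (xor-through (l a) (l c) (l d)) ⟩
      l a xor l d                                                   ∎
      where open ≡-Reasoning

  ∈-allPassages : ∀ {i p} → p ∈ circ C i → p ∈ allPassages C
  ∈-allPassages {i} p∈ = ∈-concat⁺′ p∈ (∈-tabulate⁺ i)

  module Spanning {z : HalfEdge n → Bool} (cycle : IsCycle F z) where
    open IsCycle cycle

    X : Fin n → Bool
    X u = z (entry (At.first u)) xor z (exit (At.first u))

    correction : HalfEdge n → Bool
    correction h = xorFin (λ u → X u ∧ loop u h)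

    residual : HalfEdge n → Bool
    residual h = z h xor correction h

    z-step : ∀ {p} → p ∈ allPassages C → z (entry p) xor z (exit p) ≡ X (pv p)
    z-step {p} p∈ with subst (p ∈_) (At.passages (pv p)) (∈-filter⁺ (at? (pv p)) p∈ refl)
    ... | here refl         = refl
    ... | there (here refl) = even-complement (λ i → z (pv p , i)) (even (pv p)) (At.distinct (pv p))

    correction-step : ∀ {p} → p ∈ allPassages C → correction (entry p) xor correction (exit p) ≡ X (pv p)
    correction-step {p} p∈ = begin
      correction (entry p) xor correction (exit p)
        ≡⟨ sym (xorFin-xor (λ u → X u ∧ loop u (entry p)) (λ u → X u ∧ loop u (exit p))) ⟩
      xorFin (λ u → (X u ∧ loop u (entry p)) xor (X u ∧ loop u (exit p)))
        ≡⟨ xorFin-cong (λ u → trans (sym (∧-distribˡ-xor (X u) _ _)) (cong (X u ∧_) (loop-step u p∈))) ⟩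
      xorFin (λ u → X u ∧ (pv p == u))
        ≡⟨ xorFin-select X (pv p) ⟩
      X (pv p) ∎
      where open ≡-Reasoning

    residual-step : ∀ {p} → p ∈ allPassages C → residual (entry p) ≡ residual (exit p)
    residual-step {p} p∈ = xor≡false⇒≡ (begin
      (z (entry p) xor correction (entry p)) xor (z (exit p) xor correction (exit p))
        ≡⟨ xor-interchange (z (entry p)) _ _ _ ⟩
      (z (entry p) xor z (exit p)) xor (correction (entry p) xor correction (exit p))
        ≡⟨ cong₂ _xor_ (z-step p∈) (correction-step p∈) ⟩
      X (pv p) xor X (pv p)
        ≡⟨ xor-same (X (pv p)) ⟩
      false ∎)
      where open ≡-Reasoning

    residual-σ : ∀ h → residual (σ F h) ≡ residual h
    residual-σ h = cong₂ _xor_ (σ-invariant h) (xorFin-cong λ u → cong (X u ∧_) (loop-σ u h))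

    residual-chain : ∀ {q l} → Chain F (q ∷ l) → All (_∈ allPassages C) (q ∷ l) →
                     All (λ p → residual (entry p) ≡ residual (entry q)) (q ∷ l)
    residual-chain {l = []}    _              _               = refl ∷ []
    residual-chain {q} {r ∷ l} (link , chain) (q∈ ∷ r∈ ∷ l∈) =
      refl ∷ All.map (λ eq → trans eq r≡q) (residual-chain chain (r∈ ∷ l∈))
      where
      r≡q : residual (entry r) ≡ residual (entry q)
      r≡q = trans (cong residual (sym link)) (trans (residual-σ (exit q)) (sym (residual-step q∈)))

    residual-along : ∀ {l} → Chain F l → All (_∈ allPassages C) l →
                     ∀ {p p'} → p ∈ l → p' ∈ l → residual (entry p) ≡ residual (entry p')
    residual-along {q ∷ l} chain l∈ p∈ p'∈ = trans (All.lookup constant p∈) (sym (All.lookup constant p'∈))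
      where constant = residual-chain chain l∈

    residual-vertex : ∀ v i → residual (v , i) ≡ residual (v , At.a v)
    residual-vertex v = vertex-constant
      where
      open At v
      circuit-chain : Chain F (before ++ first ∷ between ++ second ∷ after)
      circuit-chain = subst (Chain F) split (closedWalk-chain F _ (closed index))
      a≡c : residual (v , a) ≡ residual (v , c)
      a≡c = residual-along circuit-chain (subst (All (_∈ allPassages C)) split (All.tabulate ∈-allPassages))
              (∈-++⁺ʳ before (here refl)) (∈-++⁺ʳ before (there (∈-++⁺ʳ between (here refl))))
      vertex-constant : ∀ i → residual (v , i) ≡ residual (v , a)
      vertex-constant i with distinct-cover a b c d distinct i
      ... | inj₁ refl               = refl
      ... | inj₂ (inj₁ refl)        = sym (residual-step first∈)
      ... | inj₂ (inj₂ (inj₁ refl)) = sym a≡c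
      ... | inj₂ (inj₂ (inj₂ refl)) = sym (trans a≡c (residual-step second∈))

    across-residual : ∀ c → across residual c ≡ false
    across-residual (v , t) =
      trans (cong₂ _xor_ (residual-vertex v zero) (residual-vertex v (suc t))) (xor-same (residual (v , At.a v)))

    cycle-in-rowSpace : InRowSpace (M C) (across z)
    cycle-in-rowSpace = X , λ { c@(v , t) → begin
      across z c
        ≡⟨ cong₂ _xor_ (sym (xor-cancelʳ (z (v , zero)) _)) (sym (xor-cancelʳ (z (v , suc t)) _)) ⟩
      (residual (v , zero) xor correction (v , zero)) xor (residual (v , suc t) xor correction (v , suc t))
        ≡⟨ xor-interchange (residual (v , zero)) _ _ _ ⟩
      across residual c xor (correction (v , zero) xor correction (v , suc t))
        ≡⟨ cong (_xor (correction (v , zero) xor correction (v , suc t))) (across-residual c) ⟩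
      correction (v , zero) xor correction (v , suc t)
        ≡⟨ sym (xorFin-xor (λ u → X u ∧ loop u (v , zero)) (λ u → X u ∧ loop u (v , suc t))) ⟩
      xorFin (λ u → (X u ∧ loop u (v , zero)) xor (X u ∧ loop u (v , suc t)))
        ≡⟨ xorFin-cong (λ u → trans (sym (∧-distribˡ-xor (X u) _ _)) (cong (X u ∧_) (sym (row-formula u c)))) ⟩
      xorFin (λ u → X u ∧ M C u c) ∎ }
      where open ≡-Reasoning

rows-in-rowSpace : ∀ {n} {F : FourRegular n} {C C' : EulerSystem n} → IsEulerSystem F C → IsEulerSystem F C' →
                   ∀ u' → InRowSpace (M C) (M C' u')
rows-in-rowSpace E E' u' = X , λ c → trans (row-formula E' u' c) (proj₂ cycle-in-rowSpace c)
  where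
  open EulerSystemStructure using (row-formula; loop-cycle)
  open EulerSystemStructure.Spanning E (loop-cycle E' u') using (X; cycle-in-rowSpace)

proposition15 : (n : ℕ) (F : FourRegular n) (C C' : EulerSystem n) →
                IsEulerSystem F C → IsEulerSystem F C' →
                SameMatroid (M C) (M C')
proposition15 n F C C' E E' =
  sameMatroid-if-kernels {N = M C} {M C'} (kernel-antitone {N = M C} {M C'} (rows-in-rowSpace E E'))
                                          (kernel-antitone {N = M C'} {M C} (rows-in-rowSpace E' E))
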